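{- For bin packing with cardinality constraint $k=4$, First Fit satisfies $FF(L)\le 2\cdot OPT(L)$ for every input $L$; that is, First Fit has absolute competitive ratio at most $2$.
   Context: Bin packing with cardinality constraints (BPCC): there is a global integer parameter $k\ge 2$; the input is a sequence of items with sizes $s_i\in(0,1]$. Items must be partitioned into bins so that each bin has total size at most $1$ and contains at most $k$ items; the goal is to minimize the number of bins. $OPT(L)$ is the minimum number of bins for input $L$. First Fit (FF) packs each arriving item $i$ into the minimum-index (earliest opened) bin that currently has at most $k-1$ items and level at most $1-s_i$, opening a new bin if none exists; $FF(L)$ is its number of bins.
   Formalization: The item sizes $s_i$ are rational numbers in $(0,1]$. -}

module Defs where

open import Data.Nat using (ℕ; zero; suc; _<ᵇ_) renaming (_≤_ to _≤ℕ_; _+_ to _+ℕ_)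
open import Data.Bool using (Bool; true; false; if_then_else_; _∧_)
open import Data.Rational using (ℚ; 0ℚ; 1ℚ; _+_; _≤_; _<_; _≤ᵇ_)
open import Data.Fin using (Fin; _≟_)
open import Data.List using (List; []; _∷_; length; lookup; map; allFin; foldr)
open import Data.List.Relation.Unary.All using (All)
open import Data.Product using (_×_; _,_)
open import Relation.Nullary using (does)

ValidSize : ℚ → Set
ValidSize s = (0ℚ < s) × (s ≤ 1ℚ)

ValidInput : List ℚ → Set
ValidInput L = All ValidSize L

-- First Fit with cardinality bound k.
-- A bin is represented by (number of items, level); bins are kept in
-- opening order (index 0 = earliest opened).

Bin : Set
Bin = ℕ × ℚ

insertFF : ℕ → ℚ → List Bin → List Bin
insertFF k s [] = (1 , s) ∷ []
insertFF k s ((c , l) ∷ bs) =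
  if (c <ᵇ k) ∧ ((l + s) ≤ᵇ 1ℚ)
  then (suc c , l + s) ∷ bs
  else (c , l) ∷ insertFF k s bs

runFF : ℕ → List Bin → List ℚ → List Bin
runFF k bs [] = bs
runFF k bs (s ∷ L) = runFF k (insertFF k s bs) L

FF : ℕ → List ℚ → ℕ
FF k L = length (runFF k [] L)

-- Feasible packings (used to express OPT).
-- A packing of L into m bins assigns to each item a bin in Fin m.

sumℚ : List ℚ → ℚ
sumℚ = foldr _+_ 0ℚ

sumℕ : List ℕ → ℕ
sumℕ = foldr _+ℕ_ 0

binLoad : (L : List ℚ) {m : ℕ} → (Fin (length L) → Fin m) → Fin m → ℚ
binLoad L f b =
  sumℚ (map (λ i → if does (f i ≟ b) then lookup L i else 0ℚ) (allFin (length L)))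

binCount : (L : List ℚ) {m : ℕ} → (Fin (length L) → Fin m) → Fin m → ℕ
binCount L f b =
  sumℕ (map (λ i → if does (f i ≟ b) then 1 else 0) (allFin (length L)))

FeasiblePacking : ℕ → (L : List ℚ) (m : ℕ) → (Fin (length L) → Fin m) → Set
FeasiblePacking k L m f =
  (b : Fin m) → (binLoad L f b ≤ 1ℚ) × (binCount L f b ≤ℕ k)

{-# OPTIONS --safe #-}
-- Give an item of size s the rank 0, 1 or 2 and the weight 1, 2 or 4 according as s ≤ 1/4,
-- 1/4 < s ≤ 1/2 or s > 1/2, so that s is at most a quarter of its weight. A bin of a feasible
-- packing has at most 4 items, their ranks add up to at most 3 and at most one of them is large,
-- so its weight is at most 8; hence the total weight W is at most 8·OPT. Every First Fit bin of
-- weight below 4 has fewer than 4 items and level at most 3/4, so every later item exceeds 1/4;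
-- if its level is at most 1/2, every later item exceeds 1/2 and every later bin has weight 4.
-- So the First Fit bins fall short of weight 4 by at most 3 in total:
-- 4·FF ≤ W + 3 ≤ 8·OPT + 3, whence FF ≤ 2·OPT.
module Submission where

open import Defs
open import Data.Nat using (ℕ; _≤_; _*_)
open import Data.Rational using (ℚ)
open import Data.List using (List; length)
open import Data.Fin using (Fin)

open import Data.Bool using (Bool; true; false; T; if_then_else_; _∧_)
open import Data.Bool.Properties using (T-∧)
open import Data.Empty using (⊥-elim)
import Data.Fin as Fin
open import Data.Fin using (_≟_)
import Data.Integer as ℤ
open import Data.List using ([]; _∷_; map; allFin; tabulate; lookup)
import Data.List.Properties as List
open import Data.List.Membership.Propositional.Properties using (∈-lookup)
open import Data.List.Relation.Unary.All as All using (All; []; _∷_)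
open import Data.List.Relation.Unary.All.Properties using (map⁺)
open import Data.List.Relation.Unary.AllPairs using (AllPairs; []; _∷_)
open import Data.Nat using (zero; suc; _+_; _∸_; _^_; _<_; _<ᵇ_; z≤n; s≤s; _≤?_)
import Data.Nat.Properties as ℕ
open import Data.Product using (_×_; _,_; proj₁; proj₂)
open import Data.Rational using (0ℚ; 1ℚ; _≤ᵇ_; _/_)
  renaming (_+_ to _+ℚ_; _≤_ to _≤ℚ_; _<_ to _<ℚ_)
import Data.Rational.Properties as ℚ
open import Data.Sum using (_⊎_; inj₁; inj₂)
open import Function using (_∘_; id)
open import Function.Bundles using (Equivalence)
open import Relation.Binary.PropositionalEquality
  using (_≡_; refl; sym; trans; cong; subst; module ≡-Reasoning)
open import Relation.Nullary using (¬_; Dec; yes; no; does)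
open import Relation.Nullary.Decidable using (dec-true)

open import Algebra.Properties.CommutativeMonoid.Sum ℕ.+-0-commutativeMonoid
  using (sum-syntax; ∑-comm; ∑-distrib-+)
open import Algebra.Properties.CommutativeSemigroup ℕ.+-commutativeSemigroup
  using (interchange; x∙yz≈y∙xz; xy∙z≈y∙xz)
open import Algebra.Properties.Monoid.Mult ℚ.+-0-monoid using (×-homo-+) renaming (_×_ to _·_)

-- Closed rationals compute, so e.g. 4 · ¼ and 1ℚ are definitionally equal.
¼ : ℚ
¼ = ℤ.+ 1 / 4

0≤¼ : 0ℚ ≤ℚ ¼
0≤¼ = ℚ.≤ᵇ⇒≤ _

<⇒≱ : ∀ {p q} → p <ℚ q → ¬ (q ≤ℚ p)
<⇒≱ p<q q≤p = ℚ.<-irrefl refl (ℚ.<-≤-trans p<q q≤p)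

p≤q+p : ∀ {p q} → 0ℚ ≤ℚ q → p ≤ℚ q +ℚ p
p≤q+p {p} {q} 0≤q = subst (_≤ℚ q +ℚ p) (ℚ.+-identityˡ p) (ℚ.+-monoˡ-≤ p 0≤q)

p≤p+q : ∀ {p q} → 0ℚ ≤ℚ q → p ≤ℚ p +ℚ q
p≤p+q {p} {q} 0≤q = subst (_≤ℚ p +ℚ q) (ℚ.+-identityʳ p) (ℚ.+-monoʳ-≤ p 0≤q)

·-nonNeg : ∀ {u} → 0ℚ ≤ℚ u → ∀ n → 0ℚ ≤ℚ n · u
·-nonNeg 0≤u zero    = ℚ.≤-refl
·-nonNeg 0≤u (suc n) = ℚ.+-mono-≤ 0≤u (·-nonNeg 0≤u n)

·-monoˡ-≤ : ∀ {u} → 0ℚ ≤ℚ u → ∀ {m n} → m ≤ n → m · u ≤ℚ n · u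
·-monoˡ-≤     0≤u {n = n} z≤n = ·-nonNeg 0≤u n
·-monoˡ-≤ {u} 0≤u (s≤s m≤n)   = ℚ.+-monoʳ-≤ u (·-monoˡ-≤ 0≤u m≤n)

·-cancelʳ-< : ∀ {u} → 0ℚ ≤ℚ u → ∀ {m n} → m · u <ℚ n · u → m < n
·-cancelʳ-< 0≤u mu<nu = ℕ.≰⇒> (λ n≤m → <⇒≱ mu<nu (·-monoˡ-≤ 0≤u n≤m))

sumℚ-nonNeg : ∀ {xs} → All (0ℚ ≤ℚ_) xs → 0ℚ ≤ℚ sumℚ xs
sumℚ-nonNeg []       = ℚ.≤-refl
sumℚ-nonNeg (p ∷ ps) = ℚ.+-mono-≤ p (sumℚ-nonNeg ps)

*-cancelˡ-≤-+ : ∀ n {a b} → suc n * a ≤ suc n * b + n → a ≤ b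
*-cancelˡ-≤-+ n {a} {b} le = ℕ.≤-pred (ℕ.*-cancelˡ-< (suc n) a (suc b) (begin-strict
  suc n * a          ≤⟨ le ⟩
  suc n * b + n      <⟨ ℕ.+-monoʳ-< (suc n * b) (ℕ.n<1+n n) ⟩
  suc n * b + suc n  ≡⟨ ℕ.+-comm (suc n * b) (suc n) ⟩
  suc n + suc n * b  ≡⟨ ℕ.*-suc (suc n) b ⟨
  suc n * suc b      ∎))
  where open ℕ.≤-Reasoning

sumℕ-tabulate : ∀ {n} (g : Fin n → ℕ) → sumℕ (tabulate g) ≡ ∑[ i < n ] g i
sumℕ-tabulate {zero}  g = refl
sumℕ-tabulate {suc n} g = cong (g Fin.zero +_) (sumℕ-tabulate (g ∘ Fin.suc))

sumℕ-allFin : ∀ {n} (g : Fin n → ℕ) → sumℕ (map g (allFin n)) ≡ ∑[ i < n ] g i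
sumℕ-allFin g = trans (cong sumℕ (List.map-tabulate id g)) (sumℕ-tabulate g)

∑-mono-≤ : ∀ {n} {g h : Fin n → ℕ} → (∀ i → g i ≤ h i) → ∑[ i < n ] g i ≤ ∑[ i < n ] h i
∑-mono-≤ {zero}  _   = z≤n
∑-mono-≤ {suc n} g≤h = ℕ.+-mono-≤ (g≤h Fin.zero) (∑-mono-≤ (g≤h ∘ Fin.suc))

∑-≤-* : ∀ {n c} {g : Fin n → ℕ} → (∀ i → g i ≤ c) → ∑[ i < n ] g i ≤ n * c
∑-≤-* {zero}  _   = z≤n
∑-≤-* {suc n} g≤c = ℕ.+-mono-≤ (g≤c Fin.zero) (∑-≤-* (g≤c ∘ Fin.suc))

term≤∑ : ∀ {n} (g : Fin n → ℕ) i → g i ≤ ∑[ j < n ] g j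
term≤∑ g Fin.zero    = ℕ.m≤m+n (g Fin.zero) _
term≤∑ g (Fin.suc i) = ℕ.≤-trans (term≤∑ (g ∘ Fin.suc) i) (ℕ.m≤n+m _ (g Fin.zero))

rank : ℚ → ℕ
rank x with x ℚ.≤? 1 · ¼ | x ℚ.≤? 2 · ¼
... | yes _ | _     = 0
... | no _  | yes _ = 1
... | no _  | no _  = 2

weight : ℚ → ℕ
weight x = 2 ^ rank x

isLarge : ℚ → ℕ
isLarge x = rank x ∸ 1

weightSum : List ℚ → ℕ
weightSum xs = sumℕ (map weight xs)

data RankView (x : ℚ) : ℕ → Set where
  small  : x ≤ℚ 1 · ¼ → RankView x 0
  medium : 1 · ¼ <ℚ x → x ≤ℚ 2 · ¼ → RankView x 1
  large  : 2 · ¼ <ℚ x → RankView x 2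

rankView : ∀ x → RankView x (rank x)
rankView x with x ℚ.≤? 1 · ¼ | x ℚ.≤? 2 · ¼
... | yes x≤¼ | _       = small x≤¼
... | no x≰¼  | yes x≤½ = medium (ℚ.≰⇒> x≰¼) x≤½
... | no _    | no x≰½  = large (ℚ.≰⇒> x≰½)

size≤weight : ∀ {x} → x ≤ℚ 1ℚ → x ≤ℚ weight x · ¼
size≤weight {x} x≤1 with rank x | rankView x
... | _ | small x≤¼    = x≤¼
... | _ | medium _ x≤½ = x≤½
... | _ | large _      = x≤1

2≤weight : ∀ {x} → 1 ≤ rank x → 2 ≤ weight x
2≤weight = ℕ.^-monoʳ-≤ 2

weight<4⇒size≤½ : ∀ {x} → weight x < 4 → x ≤ℚ 2 · ¼
weight<4⇒size≤½ {x} w<4 with rank x | rankView x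
... | _ | small x≤¼    = ℚ.≤-trans x≤¼ (·-monoˡ-≤ 0≤¼ {1} {2} (s≤s z≤n))
... | _ | medium _ x≤½ = x≤½
... | _ | large _      = ⊥-elim (ℕ.<-irrefl refl w<4)

rank-lower : ∀ {t x} → t ≤ 2 → t · ¼ <ℚ x → t ≤ rank x
rank-lower {x = x} t≤2 t¼<x with rank x | rankView x
... | _ | small x≤¼    = ℕ.≤-pred (·-cancelʳ-< 0≤¼ (ℚ.<-≤-trans t¼<x x≤¼))
... | _ | medium _ x≤½ = ℕ.≤-pred (·-cancelʳ-< 0≤¼ (ℚ.<-≤-trans t¼<x x≤½))
... | _ | large _      = t≤2

weight-split : ∀ x → weight x ≤ 1 + rank x + isLarge x
weight-split x with rank x | rankView x
... | _ | small _    = ℕ.≤-refl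
... | _ | medium _ _ = ℕ.≤-refl
... | _ | large _    = ℕ.≤-refl

StrictlyBelow : ℚ → ℕ → ℚ → Set
StrictlyBelow u n x = n ≡ 0 ⊎ n · u <ℚ x

StrictlyBelow-+ : ∀ {u m n x y} → 0ℚ ≤ℚ x → 0ℚ ≤ℚ y →
                  StrictlyBelow u m x → StrictlyBelow u n y → StrictlyBelow u (m + n) (x +ℚ y)
StrictlyBelow-+ 0≤x 0≤y (inj₁ refl) (inj₁ refl) = inj₁ refl
StrictlyBelow-+ 0≤x 0≤y (inj₁ refl) (inj₂ nu<y) = inj₂ (ℚ.<-≤-trans nu<y (p≤q+p 0≤x))
StrictlyBelow-+ {m = m} 0≤x 0≤y (inj₂ mu<x) (inj₁ refl) rewrite ℕ.+-identityʳ m =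
  inj₂ (ℚ.<-≤-trans mu<x (p≤p+q 0≤y))
StrictlyBelow-+ {u} {m} {n} 0≤x 0≤y (inj₂ mu<x) (inj₂ nu<y) =
  inj₂ (subst (_<ℚ _) (sym (×-homo-+ u m n)) (ℚ.+-mono-< mu<x nu<y))

StrictlyBelow-sum : ∀ {u} (h : ℚ → ℕ) → (∀ x → StrictlyBelow u (h x) x) →
                    ∀ {xs} → All (0ℚ ≤ℚ_) xs → StrictlyBelow u (sumℕ (map h xs)) (sumℚ xs)
StrictlyBelow-sum h below []       = inj₁ refl
StrictlyBelow-sum h below {x ∷ xs} (p ∷ ps) =
  StrictlyBelow-+ p (sumℚ-nonNeg ps) (below x) (StrictlyBelow-sum h below ps)

StrictlyBelow⇒≤ : ∀ {u n x c} → 0ℚ ≤ℚ u → StrictlyBelow u n x → x ≤ℚ suc c · u → n ≤ c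
StrictlyBelow⇒≤ 0≤u (inj₁ refl)  _    = z≤n
StrictlyBelow⇒≤ 0≤u (inj₂ nu<x) x≤cu = ℕ.≤-pred (·-cancelʳ-< 0≤u (ℚ.<-≤-trans nu<x x≤cu))

rank-strictlyBelow : ∀ x → StrictlyBelow ¼ (rank x) x
rank-strictlyBelow x with rank x | rankView x
... | _ | small _      = inj₁ refl
... | _ | medium ¼<x _ = inj₂ ¼<x
... | _ | large ½<x    = inj₂ ½<x

isLarge-strictlyBelow : ∀ x → StrictlyBelow (2 · ¼) (isLarge x) x
isLarge-strictlyBelow x with rank x | rankView x
... | _ | small _    = inj₁ refl
... | _ | medium _ _ = inj₁ refl
... | _ | large ½<x  = inj₂ ½<x

rankSum≤3 : ∀ {xs} → All (0ℚ ≤ℚ_) xs → sumℚ xs ≤ℚ 1ℚ → sumℕ (map rank xs) ≤ 3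
rankSum≤3 nonNeg = StrictlyBelow⇒≤ 0≤¼ (StrictlyBelow-sum rank rank-strictlyBelow nonNeg)

largeCount≤1 : ∀ {xs} → All (0ℚ ≤ℚ_) xs → sumℚ xs ≤ℚ 1ℚ → sumℕ (map isLarge xs) ≤ 1
largeCount≤1 nonNeg =
  StrictlyBelow⇒≤ (·-nonNeg 0≤¼ 2) (StrictlyBelow-sum isLarge isLarge-strictlyBelow nonNeg)

-- Defs describes bin b by the list of all items with those of other bins replaced by 0ℚ.
masked-weight-split : ∀ c y → (if c then weight y else 0) ≤
                      (if c then 1 else 0) + rank (if c then y else 0ℚ) + isLarge (if c then y else 0ℚ)
masked-weight-split true  y = weight-split y
masked-weight-split false y = z≤n

masked-nonNeg : ∀ c {y} → 0ℚ ≤ℚ y → 0ℚ ≤ℚ (if c then y else 0ℚ)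
masked-nonNeg true  0≤y = 0≤y
masked-nonNeg false _   = ℚ.≤-refl

feasible-bin-weight : ∀ {L m} → ValidInput L → (f : Fin (length L) → Fin m) →
                      FeasiblePacking 4 L m f →
                      ∀ b → ∑[ i < length L ] (if does (f i ≟ b) then weight (lookup L i) else 0) ≤ 8
feasible-bin-weight {L} valid f feasible b = begin
  ∑[ i < n ] (if member i then weight (lookup L i) else 0)
    ≤⟨ ∑-mono-≤ (λ i → masked-weight-split (member i) (lookup L i)) ⟩
  ∑[ i < n ] (count i + rank (item i) + isLarge (item i))
    ≡⟨ ∑-distrib-+ (λ i → count i + rank (item i)) (isLarge ∘ item) ⟩
  ∑[ i < n ] (count i + rank (item i)) + ∑[ i < n ] isLarge (item i)
    ≡⟨ cong (_+ ∑[ i < n ] isLarge (item i)) (∑-distrib-+ count (rank ∘ item)) ⟩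
  ∑[ i < n ] count i + ∑[ i < n ] rank (item i) + ∑[ i < n ] isLarge (item i)
    ≤⟨ ℕ.+-mono-≤ (ℕ.+-mono-≤ cardinality ranks) larges ⟩
  4 + 3 + 1
    ∎
  where
  open ℕ.≤-Reasoning
  n : ℕ
  n = length L
  member : Fin n → Bool
  member i = does (f i ≟ b)
  count : Fin n → ℕ
  count i = if member i then 1 else 0
  item : Fin n → ℚ
  item i = if member i then lookup L i else 0ℚ
  nonNeg : All (0ℚ ≤ℚ_) (map item (allFin n))
  nonNeg = map⁺ (All.universal item-nonNeg (allFin n))
    where
    item-nonNeg : ∀ i → 0ℚ ≤ℚ item i
    item-nonNeg i = masked-nonNeg (member i) (ℚ.<⇒≤ (proj₁ (All.lookup valid (∈-lookup i))))
  sum-items : ∀ (h : ℚ → ℕ) → sumℕ (map h (map item (allFin n))) ≡ ∑[ i < n ] h (item i)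
  sum-items h = trans (cong sumℕ (sym (List.map-∘ (allFin n)))) (sumℕ-allFin (h ∘ item))
  cardinality : ∑[ i < n ] count i ≤ 4
  cardinality = subst (_≤ 4) (sumℕ-allFin count) (proj₂ (feasible b))
  ranks : ∑[ i < n ] rank (item i) ≤ 3
  ranks = subst (_≤ 3) (sum-items rank) (rankSum≤3 nonNeg (proj₁ (feasible b)))
  larges : ∑[ i < n ] isLarge (item i) ≤ 1
  larges = subst (_≤ 1) (sum-items isLarge) (largeCount≤1 nonNeg (proj₁ (feasible b)))

weightSum≡∑ : ∀ L → weightSum L ≡ ∑[ i < length L ] weight (lookup L i)
weightSum≡∑ L = begin
  sumℕ (map weight L)                     ≡⟨ cong (sumℕ ∘ map weight) (sym (List.tabulate-lookup L)) ⟩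
  sumℕ (map weight (tabulate (lookup L))) ≡⟨ cong sumℕ (List.map-tabulate (lookup L) weight) ⟩
  sumℕ (tabulate (weight ∘ lookup L))     ≡⟨ sumℕ-tabulate (weight ∘ lookup L) ⟩
  ∑[ i < length L ] weight (lookup L i)   ∎
  where open ≡-Reasoning

feasible-weight-bound : ∀ {L m} → ValidInput L → (f : Fin (length L) → Fin m) →
                        FeasiblePacking 4 L m f → weightSum L ≤ 8 * m
feasible-weight-bound {L} {m} valid f feasible = begin
  weightSum L                       ≡⟨ weightSum≡∑ L ⟩
  ∑[ i < n ] weight (lookup L i)    ≤⟨ ∑-mono-≤ in-own-bin ⟩
  ∑[ i < n ] ∑[ b < m ] packed i b  ≡⟨ ∑-comm packed ⟩
  ∑[ b < m ] ∑[ i < n ] packed i b  ≤⟨ ∑-≤-* (feasible-bin-weight valid f feasible) ⟩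
  m * 8                             ≡⟨ ℕ.*-comm m 8 ⟩
  8 * m                             ∎
  where
  open ℕ.≤-Reasoning
  n : ℕ
  n = length L
  packed : Fin n → Fin m → ℕ
  packed i b = if does (f i ≟ b) then weight (lookup L i) else 0
  own-bin : ∀ i → weight (lookup L i) ≤ packed i (f i)
  own-bin i rewrite dec-true (f i ≟ f i) refl = ℕ.≤-refl
  in-own-bin : ∀ i → weight (lookup L i) ≤ ∑[ b < m ] packed i b
  in-own-bin i = ℕ.≤-trans (own-bin i) (term≤∑ (packed i) (f i))

-- First Fit on bins given by their contents, newest item first; summary recovers the bins of Defs.
summary : List ℚ → Bin
summary xs = length xs , sumℚ xs

insertFF⁺ : ℕ → ℚ → List (List ℚ) → List (List ℚ)
insertFF⁺ k s [] = (s ∷ []) ∷ []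
insertFF⁺ k s (xs ∷ bs) =
  if (length xs <ᵇ k) ∧ ((sumℚ xs +ℚ s) ≤ᵇ 1ℚ)
  then (s ∷ xs) ∷ bs
  else xs ∷ insertFF⁺ k s bs

runFF⁺ : ℕ → List (List ℚ) → List ℚ → List (List ℚ)
runFF⁺ k bs []      = bs
runFF⁺ k bs (s ∷ L) = runFF⁺ k (insertFF⁺ k s bs) L

summary-insertFF⁺ : ∀ k s bs → map summary (insertFF⁺ k s bs) ≡ insertFF k s (map summary bs)
summary-insertFF⁺ k s [] = cong (λ l → (1 , l) ∷ []) (ℚ.+-identityʳ s)
summary-insertFF⁺ k s (xs ∷ bs) with (length xs <ᵇ k) ∧ ((sumℚ xs +ℚ s) ≤ᵇ 1ℚ)
... | true  = cong (λ l → (suc (length xs) , l) ∷ map summary bs) (ℚ.+-comm s (sumℚ xs))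
... | false = cong (summary xs ∷_) (summary-insertFF⁺ k s bs)

summary-runFF⁺ : ∀ k bs L → map summary (runFF⁺ k bs L) ≡ runFF k (map summary bs) L
summary-runFF⁺ k bs []      = refl
summary-runFF⁺ k bs (s ∷ L) =
  trans (summary-runFF⁺ k (insertFF⁺ k s bs) L) (cong (λ cs → runFF k cs L) (summary-insertFF⁺ k s bs))

FF≡length-runFF⁺ : ∀ k L → FF k L ≡ length (runFF⁺ k [] L)
FF≡length-runFF⁺ k L =
  trans (cong length (sym (summary-runFF⁺ k [] L))) (List.length-map summary (runFF⁺ k [] L))

record Fits (k : ℕ) (xs : List ℚ) (s : ℚ) : Set where
  constructor fits
  field
    below-cardinality : length xs < k
    below-capacity    : sumℚ xs +ℚ s ≤ℚ 1ℚ

Rejects : ℕ → List ℚ → List ℚ → Set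
Rejects k xs = All (λ y → ¬ Fits k xs y)

ValidBin : List ℚ → Set
ValidBin xs = 0 < length xs × All ValidSize xs

rejected⇒¬Fits : ∀ {k xs s} → (length xs <ᵇ k) ∧ ((sumℚ xs +ℚ s) ≤ᵇ 1ℚ) ≡ false →
                 ¬ Fits k xs s
rejected⇒¬Fits rejected (fits short light) =
  subst T rejected (Equivalence.from T-∧ (ℕ.<⇒<ᵇ short , ℚ.≤⇒≤ᵇ light))

¬Fits-∷ : ∀ {k xs s y} → 0ℚ ≤ℚ s → ¬ Fits k xs y → ¬ Fits k (s ∷ xs) y
¬Fits-∷ {xs = xs} {y = y} 0≤s ¬fits (fits short light) =
  ¬fits (fits (ℕ.<-trans (ℕ.n<1+n (length xs)) short)
              (ℚ.≤-trans (ℚ.+-monoˡ-≤ y (p≤q+p 0≤s)) light))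

insertFF⁺-All : ∀ {P : List ℚ → Set} {k s} → P (s ∷ []) → (∀ {xs} → P xs → P (s ∷ xs)) →
                ∀ {bs} → All P bs → All P (insertFF⁺ k s bs)
insertFF⁺-All new add [] = new ∷ []
insertFF⁺-All {k = k} {s} new add {xs ∷ bs} (p ∷ ps)
  with (length xs <ᵇ k) ∧ ((sumℚ xs +ℚ s) ≤ᵇ 1ℚ)
... | true  = add p ∷ ps
... | false = p ∷ insertFF⁺-All new add ps

insertFF⁺-ValidBin : ∀ {k s bs} → ValidSize s → All ValidBin bs → All ValidBin (insertFF⁺ k s bs)
insertFF⁺-ValidBin v = insertFF⁺-All (s≤s z≤n , v ∷ []) (λ (_ , vs) → s≤s z≤n , v ∷ vs)

insertFF⁺-Rejects : ∀ {k s bs} → 0ℚ ≤ℚ s → AllPairs (Rejects k) bs →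
                    AllPairs (Rejects k) (insertFF⁺ k s bs)
insertFF⁺-Rejects 0≤s [] = [] ∷ []
insertFF⁺-Rejects {k} {s} {xs ∷ bs} 0≤s (r ∷ rs)
  with (length xs <ᵇ k) ∧ ((sumℚ xs +ℚ s) ≤ᵇ 1ℚ) in accepted
... | true  = All.map (All.map (¬Fits-∷ 0≤s)) r ∷ rs
... | false = insertFF⁺-All (¬s ∷ []) (¬s ∷_) r ∷ insertFF⁺-Rejects 0≤s rs
  where
  ¬s : ¬ Fits k xs s
  ¬s = rejected⇒¬Fits accepted

runFF⁺-preserves : ∀ (I : List (List ℚ) → Set) {k} →
                   (∀ {s bs} → ValidSize s → I bs → I (insertFF⁺ k s bs)) →
                   ∀ {bs L} → ValidInput L → I bs → I (runFF⁺ k bs L)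
runFF⁺-preserves I step []       i = i
runFF⁺-preserves I step (v ∷ vs) i = runFF⁺-preserves I step vs (step v i)

totalWeight : List (List ℚ) → ℕ
totalWeight bs = sumℕ (map weightSum bs)

deficiency : List (List ℚ) → ℕ
deficiency bs = sumℕ (map (λ xs → 4 ∸ weightSum xs) bs)

totalWeight-insertFF⁺ : ∀ k s bs → totalWeight (insertFF⁺ k s bs) ≡ weight s + totalWeight bs
totalWeight-insertFF⁺ k s [] = ℕ.+-identityʳ (weight s + 0)
totalWeight-insertFF⁺ k s (xs ∷ bs) with (length xs <ᵇ k) ∧ ((sumℚ xs +ℚ s) ≤ᵇ 1ℚ)
... | true  = ℕ.+-assoc (weight s) (weightSum xs) (totalWeight bs)
... | false = trans (cong (weightSum xs +_) (totalWeight-insertFF⁺ k s bs))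
                    (x∙yz≈y∙xz (weightSum xs) (weight s) (totalWeight bs))

totalWeight-runFF⁺ : ∀ k bs L → totalWeight (runFF⁺ k bs L) ≡ totalWeight bs + weightSum L
totalWeight-runFF⁺ k bs []      = sym (ℕ.+-identityʳ (totalWeight bs))
totalWeight-runFF⁺ k bs (s ∷ L) = begin
  totalWeight (runFF⁺ k (insertFF⁺ k s bs) L)   ≡⟨ totalWeight-runFF⁺ k (insertFF⁺ k s bs) L ⟩
  totalWeight (insertFF⁺ k s bs) + weightSum L  ≡⟨ cong (_+ weightSum L) (totalWeight-insertFF⁺ k s bs) ⟩
  weight s + totalWeight bs + weightSum L       ≡⟨ xy∙z≈y∙xz (weight s) (totalWeight bs) (weightSum L) ⟩
  totalWeight bs + (weight s + weightSum L)     ∎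
  where open ≡-Reasoning

length≤weightSum : ∀ xs → length xs ≤ weightSum xs
length≤weightSum []       = z≤n
length≤weightSum (x ∷ xs) = ℕ.+-mono-≤ (ℕ.m^n>0 2 (rank x)) (length≤weightSum xs)

load≤weightSum : ∀ {xs} → All ValidSize xs → sumℚ xs ≤ℚ weightSum xs · ¼
load≤weightSum []                         = ℚ.≤-refl
load≤weightSum {x ∷ xs} ((_ , x≤1) ∷ vs) = begin
  x +ℚ sumℚ xs                      ≤⟨ ℚ.+-mono-≤ (size≤weight x≤1) (load≤weightSum vs) ⟩
  weight x · ¼ +ℚ weightSum xs · ¼  ≡⟨ ×-homo-+ ¼ (weight x) (weightSum xs) ⟨
  (weight x + weightSum xs) · ¼     ∎
  where open ℚ.≤-Reasoning

2^≤weightSum : ∀ {t xs} → 0 < length xs → All (λ x → t ≤ rank x) xs → 2 ^ t ≤ weightSum xs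
2^≤weightSum {xs = x ∷ xs} _ (t≤r ∷ _) =
  ℕ.≤-trans (ℕ.^-monoʳ-≤ 2 t≤r) (ℕ.m≤m+n (weight x) (weightSum xs))

nonSmall-unfilled-load : ∀ {xs} → All (λ x → 1 ≤ rank x) xs → weightSum xs < 4 →
                         sumℚ xs ≤ℚ 2 · ¼
nonSmall-unfilled-load [] _ = ·-nonNeg 0≤¼ 2
nonSmall-unfilled-load {x ∷ []} (_ ∷ []) w<4 =
  subst (_≤ℚ 2 · ¼) (sym (ℚ.+-identityʳ x))
        (weight<4⇒size≤½ (subst (_< 4) (ℕ.+-identityʳ (weight x)) w<4))
nonSmall-unfilled-load {x ∷ y ∷ xs} (1≤x ∷ 1≤y ∷ _) w<4 = ⊥-elim (ℕ.<⇒≱ w<4 (begin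
  2 + 2                                ≤⟨ ℕ.+-mono-≤ (2≤weight 1≤x) (2≤weight 1≤y) ⟩
  weight x + weight y                  ≤⟨ ℕ.+-monoʳ-≤ (weight x) (ℕ.m≤m+n (weight y) (weightSum xs)) ⟩
  weight x + (weight y + weightSum xs) ∎))
  where open ℕ.≤-Reasoning

rejected-size : ∀ {k xs y t} → ¬ Fits k xs y → length xs < k → t ≤ 4 →
                sumℚ xs ≤ℚ (4 ∸ t) · ¼ → t · ¼ <ℚ y
rejected-size {xs = xs} {y} {t} ¬fits short t≤4 load = ℚ.≰⇒> (λ y≤t¼ → ¬fits (fits short (begin
  sumℚ xs +ℚ y          ≤⟨ ℚ.+-mono-≤ load y≤t¼ ⟩
  (4 ∸ t) · ¼ +ℚ t · ¼  ≡⟨ ×-homo-+ ¼ (4 ∸ t) t ⟨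
  (4 ∸ t + t) · ¼       ≡⟨ cong (_· ¼) (ℕ.m∸n+n≡m t≤4) ⟩
  4 · ¼                 ∎)))
  where open ℚ.≤-Reasoning

Rejects⇒rank : ∀ {xs ys t} → t ≤ 2 → length xs < 4 → sumℚ xs ≤ℚ (4 ∸ t) · ¼ →
               Rejects 4 xs ys → All (λ y → t ≤ rank y) ys
Rejects⇒rank {t = t} t≤2 short load =
  All.map (λ ¬fits → rank-lower t≤2 (rejected-size ¬fits short t≤4 load))
  where
  t≤4 : t ≤ 4
  t≤4 = ℕ.≤-trans t≤2 (ℕ.m≤m+n 2 2)

deficiency-bound : ∀ t {bs} → All ValidBin bs → AllPairs (Rejects 4) bs →
                   All (All (λ x → t ≤ rank x)) bs → deficiency bs ≤ 4 ∸ 2 ^ t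
deficiency-bound t [] [] [] = z≤n
deficiency-bound t {xs ∷ bs} ((nonempty , valid) ∷ vbs) (rxs ∷ rbs) (txs ∷ tbs)
  with 4 ≤? weightSum xs
... | yes full = begin
  (4 ∸ weightSum xs) + deficiency bs  ≡⟨ cong (_+ deficiency bs) (ℕ.m≤n⇒m∸n≡0 full) ⟩
  deficiency bs                       ≤⟨ deficiency-bound t vbs rbs tbs ⟩
  4 ∸ 2 ^ t                           ∎
  where open ℕ.≤-Reasoning
... | no unfilled = by-load (sumℚ xs ℚ.≤? 2 · ¼) t txs
  where
  W<4 : weightSum xs < 4
  W<4 = ℕ.≰⇒> unfilled
  short : length xs < 4
  short = ℕ.≤-<-trans (length≤weightSum xs) W<4
  by-load : Dec (sumℚ xs ≤ℚ 2 · ¼) → ∀ r → All (λ x → r ≤ rank x) xs →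
            (4 ∸ weightSum xs) + deficiency bs ≤ 4 ∸ 2 ^ r
  by-load (yes half) r ranked = begin
    (4 ∸ weightSum xs) + deficiency bs  ≤⟨ ℕ.+-mono-≤ own later ⟩
    (4 ∸ 2 ^ r) + 0                     ≡⟨ ℕ.+-identityʳ (4 ∸ 2 ^ r) ⟩
    4 ∸ 2 ^ r                           ∎
    where
    open ℕ.≤-Reasoning
    own : 4 ∸ weightSum xs ≤ 4 ∸ 2 ^ r
    own = ℕ.∸-monoʳ-≤ 4 (2^≤weightSum nonempty ranked)
    later : deficiency bs ≤ 0
    later = deficiency-bound 2 vbs rbs (All.map (Rejects⇒rank ℕ.≤-refl short half) rxs)
  by-load (no over) zero _ = ℕ.+-mono-≤ (ℕ.∸-monoʳ-≤ 4 3≤W) later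
    where
    3≤W : 3 ≤ weightSum xs
    3≤W = ·-cancelʳ-< 0≤¼ (ℚ.<-≤-trans (ℚ.≰⇒> over) (load≤weightSum valid))
    load : sumℚ xs ≤ℚ 3 · ¼
    load = ℚ.≤-trans (load≤weightSum valid) (·-monoˡ-≤ 0≤¼ (ℕ.≤-pred W<4))
    later : deficiency bs ≤ 2
    later = deficiency-bound 1 vbs rbs (All.map (Rejects⇒rank (s≤s z≤n) short load) rxs)
  by-load (no over) (suc _) ranked =
    ⊥-elim (over (nonSmall-unfilled-load (All.map (ℕ.≤-trans (s≤s z≤n)) ranked) W<4))

length-bound : ∀ bs → 4 * length bs ≤ totalWeight bs + deficiency bs
length-bound []        = z≤n
length-bound (xs ∷ bs) = begin
  4 * suc (length bs)                       ≡⟨ ℕ.*-suc 4 (length bs) ⟩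
  4 + 4 * length bs                         ≤⟨ ℕ.+-mono-≤ (ℕ.m≤n+m∸n 4 W) (length-bound bs) ⟩
  (W + (4 ∸ W)) + (totalWeight bs + deficiency bs)
    ≡⟨ interchange W (4 ∸ W) (totalWeight bs) (deficiency bs) ⟩
  (W + totalWeight bs) + ((4 ∸ W) + deficiency bs) ∎
  where
  open ℕ.≤-Reasoning
  W : ℕ
  W = weightSum xs

firstFit-weight-bound : ∀ {L} → ValidInput L → 4 * FF 4 L ≤ weightSum L + 3
firstFit-weight-bound {L} valid = begin
  4 * FF 4 L                          ≡⟨ cong (4 *_) (FF≡length-runFF⁺ 4 L) ⟩
  4 * length bins                     ≤⟨ length-bound bins ⟩
  totalWeight bins + deficiency bins  ≤⟨ ℕ.+-monoʳ-≤ (totalWeight bins) deficient ⟩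
  totalWeight bins + 3                ≡⟨ cong (_+ 3) (totalWeight-runFF⁺ 4 [] L) ⟩
  weightSum L + 3                     ∎
  where
  open ℕ.≤-Reasoning
  bins : List (List ℚ)
  bins = runFF⁺ 4 [] L
  validBins : All ValidBin bins
  validBins = runFF⁺-preserves (All ValidBin) insertFF⁺-ValidBin valid []
  rejects : AllPairs (Rejects 4) bins
  rejects = runFF⁺-preserves (AllPairs (Rejects 4)) (λ (0<s , _) → insertFF⁺-Rejects (ℚ.<⇒≤ 0<s))
                             valid []
  deficient : deficiency bins ≤ 3
  deficient = deficiency-bound 0 validBins rejects (All.universal (All.universal (λ _ → z≤n)) bins)

mainTheorem7 : (L : List ℚ) → ValidInput L →
    (m : ℕ) (f : Fin (length L) → Fin m) → FeasiblePacking 4 L m f →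
    FF 4 L ≤ 2 * m
mainTheorem7 L valid m f feasible = *-cancelˡ-≤-+ 3 (begin
  4 * FF 4 L       ≤⟨ firstFit-weight-bound valid ⟩
  weightSum L + 3  ≤⟨ ℕ.+-monoˡ-≤ 3 (feasible-weight-bound valid f feasible) ⟩
  8 * m + 3        ≡⟨ cong (_+ 3) (ℕ.*-assoc 4 2 m) ⟩
  4 * (2 * m) + 3  ∎)
  where open ℕ.≤-Reasoning
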